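{- Let $(F;\unlhd)$ be a finite quasi-forest, and let $\mathcal{V}(F,\unlhd)$ and the linear order $\le$ on it be as follows: $\nu(t)=\{s\in F:s\unlhd t\}$, $\mathcal{V}(F,\unlhd)=\{\nu(t):t\in F\}\cup\{\emptyset\}$ ordered as a tree by inclusion; given an arbitrary linear order $\le^*$ on each level of this tree, $p<q$ if $p\subsetneq q$, and if $p,q$ are $\subseteq$-incomparable then $p<q$ iff $p^*<^*q^*$, where $p^*$ is the $\subseteq$-minimal element with $p\cap q\subsetneq p^*\subseteq p$ and $q^*$ is defined symmetrically. For $p,q\in\mathcal{V}(F,\unlhd)$ let $\mathrm{dist}(p,q)=|p\,\triangle\,q|$. Then for any $p_0<\dots<p_m$ in $\mathcal{V}(F,\unlhd)$, \[\sum_{i<m}\mathrm{dist}(p_i,p_{i+1})\le 2|F|.\]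
   Context: A quasi-forest is a set with a preorder $\unlhd$ such that for each $t$ the set $\{s:s\unlhd t\}$ is linearly preordered by $\unlhd$. $\triangle$ denotes symmetric difference. -}

module Defs where

open import Level using (0ℓ)
open import Data.Nat using (ℕ; zero; suc; _+_; _*_; _≤_)
open import Data.Fin using (Fin; inject₁) renaming (suc to fsuc)
open import Data.Fin.Subset using (Subset; _∈_; _⊆_; _⊂_; _∩_; _∪_; _─_; ∣_∣; ⊥)
open import Data.List using (List; map; allFin)
open import Data.Nat.ListAction using (sum)
open import Data.Product using (Σ; ∃; _×_; _,_)
open import Data.Sum using (_⊎_)
open import Relation.Binary using (Rel)
open import Relation.Binary.PropositionalEquality using (_≡_; _≢_)
open import Relation.Nullary using (¬_)
open import Function.Bundles using (_⇔_)

record IsQuasiForest {n : ℕ} (_⊴_ : Rel (Fin n) 0ℓ) : Set where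
  field
    ⊴-refl  : ∀ t → t ⊴ t
    ⊴-trans : ∀ {r s t} → r ⊴ s → s ⊴ t → r ⊴ t
    ⊴-linear-below : ∀ {s₁ s₂ t} → s₁ ⊴ t → s₂ ⊴ t → (s₁ ⊴ s₂) ⊎ (s₂ ⊴ s₁)

module _ {n : ℕ} (_⊴_ : Rel (Fin n) 0ℓ) where

  IsNu : Subset n → Fin n → Set
  IsNu p t = ∀ s → (s ∈ p) ⇔ (s ⊴ t)

  InV : Subset n → Set
  InV p = (p ≡ ⊥) ⊎ ∃ (IsNu p)

  ImmSucc : Subset n → Subset n → Set
  ImmSucc p q = InV p × InV q × p ⊂ q ×
                (∀ r → InV r → p ⊂ r → ¬ (r ⊂ q))

  data Depth : Subset n → ℕ → Set where
    root : Depth ⊥ 0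
    step : ∀ {p q k} → Depth p k → ImmSucc p q → Depth q (suc k)

  SameLevel : Subset n → Subset n → Set
  SameLevel p q = ∃ λ k → Depth p k × Depth q k

  record LevelwiseLinear (_≤*_ : Rel (Subset n) 0ℓ) : Set where
    field
      ≤*-antisym : ∀ {p q} → SameLevel p q → p ≤* q → q ≤* p → p ≡ q
      ≤*-trans   : ∀ {p q r} → SameLevel p q → SameLevel q r →
                   p ≤* q → q ≤* r → p ≤* r
      ≤*-total   : ∀ {p q} → SameLevel p q → (p ≤* q) ⊎ (q ≤* p)

  IsStar : Subset n → Subset n → Subset n → Set
  IsStar p q p* = InV p* × (p ∩ q) ⊂ p* × p* ⊆ p ×
                  (∀ r → InV r → (p ∩ q) ⊂ r → r ⊆ p → ¬ (r ⊂ p*))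

  Incomparable : Subset n → Subset n → Set
  Incomparable p q = ¬ (p ⊆ q) × ¬ (q ⊆ p)

  module _ (_≤*_ : Rel (Subset n) 0ℓ) where

    _<*_ : Subset n → Subset n → Set
    a <* b = a ≤* b × a ≢ b

    _≺_ : Subset n → Subset n → Set
    p ≺ q = (p ⊂ q) ⊎
            (Incomparable p q ×
             ∃ λ p* → ∃ λ q* → IsStar p q p* × IsStar q p q* × p* <* q*)

_△_ : ∀ {n} → Subset n → Subset n → Subset n
p △ q = (p ─ q) ∪ (q ─ p)

dist : ∀ {n} → Subset n → Subset n → ℕ
dist p q = ∣ p △ q ∣

pathLength : ∀ {n} (m : ℕ) → (Fin (suc m) → Subset n) → ℕ
pathLength m p = sum (map (λ i → dist (p (inject₁ i)) (p (fsuc i))) (allFin m))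

-- Give every vertex s a weight: 2 while ν(s) has not been met, 1 while the
-- current element contains s, and 0 once the walk has moved past ν(s) without
-- containing s.  Along p₀ < ⋯ < pₘ the weight of s never increases, and it
-- drops whenever s enters or leaves: an element containing s but followed by
-- one that does not is never returned to, since the order is a depth-first
-- order of the tree.  So each step costs at least dist(pᵢ, pᵢ₊₁) of a total
-- weight that starts at most at 2|F|.  The argument needs ⊴ and "s is passed"
-- to be decidable, which is harmless because the conclusion is decidable.
module Submission where

open import Defs
open import Level using (0ℓ)
import Data.Nat.Properties as ℕ
open import Algebra.Properties.CommutativeSemigroup ℕ.+-commutativeSemigroup using (x∙yz≈y∙xz)
open import Data.Bool.Properties using (T-≡)
open import Data.Empty using (⊥-elim)
open import Data.Fin using (Fin; inject₁; fromℕ) renaming (zero to fzero; suc to fsuc)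
open import Data.Fin.Properties using (¬∀⟶∃¬)
open import Data.Fin.Subset
open import Data.Fin.Subset.Properties
open import Data.List as List using (List; tabulate; allFin)
open import Data.List.Properties using (map-tabulate)
open import Data.List.Membership.Propositional using () renaming (_∈_ to _∈ₗ_)
open import Data.List.Membership.Propositional.Properties using (∈-allFin)
open import Data.List.Relation.Unary.Any as Any using ()
open import Data.Nat using (ℕ; zero; suc; _+_; _*_; _≤_; _<_; _≤?_; z≤n; s≤s)
open import Data.Nat.Induction using (<-wellFounded)
open import Data.Nat.ListAction using (sum)
open import Data.Nat.Properties using (≤-refl; ≤-trans; ≤-reflexive; +-mono-≤; +-monoʳ-≤; +-assoc; m≤m+n; *-suc)
open import Data.Product using (∃; ∃₂; _×_; _,_; proj₁; proj₂)
open import Data.Sum using (_⊎_; inj₁; inj₂; [_,_]′)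
open import Data.Vec as Vec using ([]; _∷_; here; there)
open import Data.Vec.Properties using (lookup∘tabulate; []=⇒lookup; lookup⇒[]=)
open import Function using (_∘_; id; _on_)
open import Function.Bundles using (mk⇔; Equivalence)
open import Induction.WellFounded using (Acc; acc)
open import Relation.Binary using (Rel)
open import Relation.Binary.Construct.On as On using ()
open import Relation.Binary.PropositionalEquality
open import Relation.Nullary using (¬_; Dec; yes; no; isYes; _×-dec_; ¬?; _→-dec_)
open import Relation.Nullary.Decidable using (toWitness; fromWitness; decidable-stable; ¬¬-excluded-middle)
open import Relation.Unary using (Decidable)

open Equivalence using (to; from)

private variable k : ℕ

subsetOf : {P : Fin k → Set} → Decidable P → Subset k
subsetOf P? = Vec.tabulate (isYes ∘ P?)

∈-subsetOf⁺ : {P : Fin k → Set} (P? : Decidable P) {x : Fin k} → P x → x ∈ subsetOf P?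
∈-subsetOf⁺ P? {x} px =
  lookup⇒[]= x _ (trans (lookup∘tabulate (isYes ∘ P?) x) (to T-≡ (fromWitness {a? = P? x} px)))

∈-subsetOf⁻ : {P : Fin k → Set} (P? : Decidable P) {x : Fin k} → x ∈ subsetOf P? → P x
∈-subsetOf⁻ P? {x} x∈ =
  toWitness {a? = P? x} (from T-≡ (trans (sym (lookup∘tabulate (isYes ∘ P?) x)) ([]=⇒lookup x∈)))

⊈⇒∃∉ : {p q : Subset k} → ¬ (p ⊆ q) → ∃ λ x → x ∈ p × x ∉ q
⊈⇒∃∉ {k} {p} {q} p⊈q
  with ¬∀⟶∃¬ k (λ x → x ∈ p → x ∈ q) (λ x → x ∈? p →-dec x ∈? q) (λ p⊆q → p⊈q (p⊆q _))
... | x , x∈p↛x∈q =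
  x , decidable-stable (x ∈? p) (λ x∉p → x∈p↛x∈q (⊥-elim ∘ x∉p)) , (λ x∈q → x∈p↛x∈q (λ _ → x∈q))

⊆⇒≡⊎⊂ : {p q : Subset k} → p ⊆ q → p ≡ q ⊎ p ⊂ q
⊆⇒≡⊎⊂ {p = p} {q} p⊆q with q ⊆? p
... | yes q⊆p = inj₁ (⊆-antisym p⊆q q⊆p)
... | no q⊈p  = inj₂ (p⊆q , ⊈⇒∃∉ q⊈p)

⊆-total⇒⊂-tri : {p q : Subset k} → p ⊆ q ⊎ q ⊆ p → p ⊂ q ⊎ p ≡ q ⊎ q ⊂ p
⊆-total⇒⊂-tri (inj₁ p⊆q) with ⊆⇒≡⊎⊂ p⊆q
... | inj₁ p≡q = inj₂ (inj₁ p≡q)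
... | inj₂ p⊂q = inj₁ p⊂q
⊆-total⇒⊂-tri (inj₂ q⊆p) with ⊆⇒≡⊎⊂ q⊆p
... | inj₁ q≡p = inj₂ (inj₁ (sym q≡p))
... | inj₂ q⊂p = inj₂ (inj₂ q⊂p)

x∈p─q⇒x∉q : ∀ (p q : Subset k) {x} → x ∈ p ─ q → x ∉ q
x∈p─q⇒x∉q (_ ∷ p) (inside  ∷ q) ()        here
x∈p─q⇒x∉q (_ ∷ p) (outside ∷ q) here      ()
x∈p─q⇒x∉q (_ ∷ p) (_       ∷ q) (there x) (there y) = x∈p─q⇒x∉q p q x y

x∈p△q⁻ : ∀ (p q : Subset k) {x} → x ∈ p △ q → (x ∈ p × x ∉ q) ⊎ (x ∈ q × x ∉ p)
x∈p△q⁻ p q x∈ with x∈p∪q⁻ (p ─ q) (q ─ p) x∈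
... | inj₁ x∈p─q = inj₁ (p─q⊆p p q x∈p─q , x∈p─q⇒x∉q p q x∈p─q)
... | inj₂ x∈q─p = inj₂ (p─q⊆p q p x∈q─p , x∈p─q⇒x∉q q p x∈q─p)

x∈p∧x∈q⇒x∉p△q : ∀ (p q : Subset k) {x} → x ∈ p → x ∈ q → x ∉ p △ q
x∈p∧x∈q⇒x∉p△q p q x∈p x∈q x∈△ =
  [ (λ (_ , x∉q) → x∉q x∈q) , (λ (_ , x∉p) → x∉p x∈p) ]′ (x∈p△q⁻ p q x∈△)

x∉p∧x∉q⇒x∉p△q : ∀ (p q : Subset k) {x} → x ∉ p → x ∉ q → x ∉ p △ q
x∉p∧x∉q⇒x∉p△q p q x∉p x∉q x∈△ =
  [ (λ (x∈p , _) → x∉p x∈p) , (λ (x∈q , _) → x∉q x∈q) ]′ (x∈p△q⁻ p q x∈△)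

∣p∣+sum≤sum : (S : Subset k) (f g : Fin k → ℕ) →
              (∀ x → g x ≤ f x) → (∀ x → x ∈ S → g x < f x) →
              ∣ S ∣ + sum (tabulate g) ≤ sum (tabulate f)
∣p∣+sum≤sum []            f g g≤f g<f = z≤n
∣p∣+sum≤sum (inside ∷ S)  f g g≤f g<f =
  ≤-trans (≤-reflexive (cong suc (x∙yz≈y∙xz ∣ S ∣ (g fzero) _)))
          (+-mono-≤ (g<f fzero here)
                    (∣p∣+sum≤sum S (f ∘ fsuc) (g ∘ fsuc) (g≤f ∘ fsuc) (λ x → g<f (fsuc x) ∘ there)))
∣p∣+sum≤sum (outside ∷ S) f g g≤f g<f =
  ≤-trans (≤-reflexive (x∙yz≈y∙xz ∣ S ∣ (g fzero) _))
          (+-mono-≤ (g≤f fzero)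
                    (∣p∣+sum≤sum S (f ∘ fsuc) (g ∘ fsuc) (g≤f ∘ fsuc) (λ x → g<f (fsuc x) ∘ there)))

sum-tabulate-≤ : (c : ℕ) (f : Fin k → ℕ) → (∀ x → f x ≤ c) → sum (tabulate f) ≤ c * k
sum-tabulate-≤ {zero}  c f f≤c = z≤n
sum-tabulate-≤ {suc k} c f f≤c =
  ≤-trans (+-mono-≤ (f≤c fzero) (sum-tabulate-≤ c (f ∘ fsuc) (f≤c ∘ fsuc)))
          (≤-reflexive (sym (*-suc c k)))

sum≤telescope : (m : ℕ) (Φ : Fin (suc m) → ℕ) (d : Fin m → ℕ) →
                (∀ i → d i + Φ (fsuc i) ≤ Φ (inject₁ i)) →
                sum (tabulate d) + Φ (fromℕ m) ≤ Φ fzero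
sum≤telescope zero    Φ d descent = ≤-refl
sum≤telescope (suc m) Φ d descent =
  ≤-trans (≤-reflexive (+-assoc (d fzero) (sum (tabulate (d ∘ fsuc))) _))
          (≤-trans (+-monoʳ-≤ (d fzero) (sum≤telescope m (Φ ∘ fsuc) (d ∘ fsuc) (descent ∘ fsuc)))
                   (descent fzero))

¬¬-∀Fin : (Q : Fin k → Set) → (∀ i → ¬ ¬ Q i) → ¬ ¬ (∀ i → Q i)
¬¬-∀Fin {zero}  Q ¬¬Q ¬∀Q = ¬∀Q (λ ())
¬¬-∀Fin {suc k} Q ¬¬Q ¬∀Q =
  ¬¬Q fzero λ Q₀ → ¬¬-∀Fin (Q ∘ fsuc) (¬¬Q ∘ fsuc) λ Qₛ →
    ¬∀Q λ { fzero → Q₀ ; (fsuc i) → Qₛ i }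

¬¬-decidable : (Q : Fin k → Set) → ¬ ¬ (∀ i → Dec (Q i))
¬¬-decidable Q = ¬¬-∀Fin (Dec ∘ Q) (λ _ → ¬¬-excluded-middle)

module _ {n : ℕ} {_⊴_ : Rel (Fin n) 0ℓ} (QF : IsQuasiForest _⊴_) where

  open IsQuasiForest QF

  private
    𝒱 : Subset n → Set
    𝒱 = InV _⊴_

  DownClosed : Subset n → Set
  DownClosed D = ∀ {x y} → x ∈ D → y ⊴ x → y ∈ D

  𝒱-downClosed : ∀ {p} → 𝒱 p → DownClosed p
  𝒱-downClosed (inj₁ refl)       x∈⊥ _   = ⊥-elim (∉⊥ x∈⊥)
  𝒱-downClosed (inj₂ (t , p≐νt)) x∈p y⊴x = from (p≐νt _) (⊴-trans y⊴x (to (p≐νt _) x∈p))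

  𝒱-linear : ∀ {p x y} → 𝒱 p → x ∈ p → y ∈ p → x ⊴ y ⊎ y ⊴ x
  𝒱-linear (inj₁ refl)       x∈⊥ _   = ⊥-elim (∉⊥ x∈⊥)
  𝒱-linear (inj₂ (t , p≐νt)) x∈p y∈p = ⊴-linear-below (to (p≐νt _) x∈p) (to (p≐νt _) y∈p)

  downClosed-⊆-total : ∀ {p q r} → DownClosed p → DownClosed q → 𝒱 r →
                       p ⊆ r → q ⊆ r → p ⊆ q ⊎ q ⊆ p
  downClosed-⊆-total {p} {q} dp dq vr p⊆r q⊆r with p ⊆? q
  ... | yes p⊆q = inj₁ p⊆q
  ... | no p⊈q with ⊈⇒∃∉ p⊈q
  ... | x , x∈p , x∉q = inj₂ λ y∈q →
    [ (λ x⊴y → ⊥-elim (x∉q (dq y∈q x⊴y))) , dp x∈p ]′ (𝒱-linear vr (p⊆r x∈p) (q⊆r y∈q))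

  ∃-greatest : (D : Subset n) → (∀ {x y} → x ∈ D → y ∈ D → x ⊴ y ⊎ y ⊴ x) → Nonempty D →
               ∃ λ u → u ∈ D × (∀ {x} → x ∈ D → x ⊴ u)
  ∃-greatest D linear (u₀ , u₀∈D) with greatestAmong (allFin n)
    where
    greatestAmong : (xs : List (Fin n)) → ∃ λ u → u ∈ D × (∀ {x} → x ∈ₗ xs → x ∈ D → x ⊴ u)
    greatestAmong List.[] = u₀ , u₀∈D , λ ()
    greatestAmong (x List.∷ xs) with greatestAmong xs | x ∈? D
    ... | u , u∈D , ≤u | no x∉D =
      u , u∈D , λ { (Any.here refl) x∈D → ⊥-elim (x∉D x∈D) ; (Any.there y∈) → ≤u y∈ }
    ... | u , u∈D , ≤u | yes x∈D with linear x∈D u∈D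
    ... | inj₁ x⊴u = u , u∈D , λ { (Any.here refl) _ → x⊴u ; (Any.there y∈) → ≤u y∈ }
    ... | inj₂ u⊴x =
      x , x∈D , λ { (Any.here refl) _ → ⊴-refl x ; (Any.there y∈) y∈D → ⊴-trans (≤u y∈ y∈D) u⊴x }
  ... | u , u∈D , ≤u = u , u∈D , ≤u (∈-allFin _)

  downClosed⇒𝒱 : ∀ {D r} → DownClosed D → 𝒱 r → D ⊆ r → 𝒱 D
  downClosed⇒𝒱 {D} dD vr D⊆r with nonempty? D
  ... | no D-empty = inj₁ (Empty-unique D-empty)
  ... | yes D-nonempty with ∃-greatest D (λ x∈D y∈D → 𝒱-linear vr (D⊆r x∈D) (D⊆r y∈D)) D-nonempty
  ... | u , u∈D , ≤u = inj₂ (u , λ s → mk⇔ ≤u (dD u∈D))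

  ∩-𝒱 : ∀ {p q} → 𝒱 p → 𝒱 q → 𝒱 (p ∩ q)
  ∩-𝒱 {p} {q} vp vq = downClosed⇒𝒱 dc vp (p∩q⊆p p q)
    where
    dc : DownClosed (p ∩ q)
    dc x∈ y⊴x = x∈p∩q⁺ ( 𝒱-downClosed vp (proj₁ (x∈p∩q⁻ p q x∈)) y⊴x
                       , 𝒱-downClosed vq (proj₂ (x∈p∩q⁻ p q x∈)) y⊴x )

  -- Each y ∈ a ∩ b is comparable with x inside b; it is not above x as x ∉ a,
  -- so it is below x ∈ c.
  ∩-pivot : ∀ {a b c x} → 𝒱 b → DownClosed a → DownClosed c →
            x ∈ b → x ∈ c → x ∉ a → a ∩ c ⊆ b → a ∩ b ≡ a ∩ c
  ∩-pivot {a} {b} {c} vb da dc x∈b x∈c x∉a a∩c⊆b =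
    ⊆-antisym ⊆c (λ y∈ → x∈p∩q⁺ (p∩q⊆p a c y∈ , a∩c⊆b y∈))
    where
    ⊆c : a ∩ b ⊆ a ∩ c
    ⊆c {y} y∈ with x∈p∩q⁻ a b y∈
    ... | y∈a , y∈b = [ (λ y⊴x → x∈p∩q⁺ (y∈a , dc x∈c y⊴x)) , (λ x⊴y → ⊥-elim (x∉a (da y∈a x⊴y))) ]′
                        (𝒱-linear vb y∈b x∈b)

  -- X is the child of m on the branch of the tree leading to x; for m = p ∩ q
  -- and x = p this is the paper's p*.
  ChildToward : Subset n → Subset n → Subset n → Set
  ChildToward m x X = 𝒱 X × m ⊂ X × X ⊆ x × (∀ r → 𝒱 r → m ⊂ r → ¬ (r ⊂ X))

  childToward-least : ∀ {m x X r} → 𝒱 x → ChildToward m x X → 𝒱 r → m ⊂ r → r ⊆ x → X ⊆ r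
  childToward-least vx (vX , m⊂X , X⊆x , minimal) vr m⊂r r⊆x
    with downClosed-⊆-total (𝒱-downClosed vX) (𝒱-downClosed vr) vx X⊆x r⊆x
  ... | inj₁ X⊆r = X⊆r
  ... | inj₂ r⊆X with ⊆⇒≡⊎⊂ r⊆X
  ...   | inj₁ r≡X = ⊆-reflexive (sym r≡X)
  ...   | inj₂ r⊂X = ⊥-elim (minimal _ vr m⊂r r⊂X)

  childToward-unique : ∀ {m x X Y} → 𝒱 x → ChildToward m x X → ChildToward m x Y → X ≡ Y
  childToward-unique vx cX@(vX , m⊂X , X⊆x , _) cY@(vY , m⊂Y , Y⊆x , _) =
    ⊆-antisym (childToward-least vx cX vY m⊂Y Y⊆x) (childToward-least vx cY vX m⊂X X⊆x)

  childToward-widen : ∀ {m x y X} → X ⊆ y → ChildToward m x X → ChildToward m y X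
  childToward-widen X⊆y (vX , m⊂X , _ , minimal) = vX , m⊂X , X⊆y , minimal

  childToward⇒⊈ : ∀ {m a b Y} → a ∩ b ≡ m → ChildToward m b Y → ¬ (b ⊆ a)
  childToward⇒⊈ {a = a} {b} refl (_ , (_ , y , y∈Y , y∉a∩b) , Y⊆b , _) b⊆a =
    y∉a∩b (x∈p∩q⁺ (b⊆a (Y⊆b y∈Y) , Y⊆b y∈Y))

  isStar⇒childToward : ∀ {p q X} → IsStar _⊴_ p q X → ChildToward (p ∩ q) p X
  isStar⇒childToward (vX , m⊂X , X⊆p , minimal) =
    vX , m⊂X , X⊆p , λ r vr m⊂r r⊂X → minimal r vr m⊂r (⊆-trans (p⊂q⇒p⊆q r⊂X) X⊆p) r⊂X

  childToward⇒isStar : ∀ {p q X} → ChildToward (p ∩ q) p X → IsStar _⊴_ p q X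
  childToward⇒isStar (vX , m⊂X , X⊆p , minimal) = vX , m⊂X , X⊆p , λ r vr m⊂r _ → minimal r vr m⊂r

  module _ (_⊴?_ : Relation.Binary.Decidable _⊴_) where

    ν : Fin n → Subset n
    ν t = subsetOf (_⊴? t)

    ν-𝒱 : ∀ t → 𝒱 (ν t)
    ν-𝒱 t = inj₂ (t , λ s → mk⇔ (∈-subsetOf⁻ (_⊴? t)) (∈-subsetOf⁺ (_⊴? t)))

    t∈νt : ∀ t → t ∈ ν t
    t∈νt t = ∈-subsetOf⁺ (_⊴? t) (⊴-refl t)

    ν⊆ : ∀ {p t} → 𝒱 p → t ∈ p → ν t ⊆ p
    ν⊆ {t = t} vp t∈p s∈νt = 𝒱-downClosed vp t∈p (∈-subsetOf⁻ (_⊴? t) s∈νt)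

    isNu⇒≡ν : ∀ {p t} → IsNu _⊴_ p t → p ≡ ν t
    isNu⇒≡ν {t = t} p≐νt =
      ⊆-antisym (∈-subsetOf⁺ (_⊴? t) ∘ to (p≐νt _)) (from (p≐νt _) ∘ ∈-subsetOf⁻ (_⊴? t))

    strictlyBelow : Fin n → Subset n
    strictlyBelow t = subsetOf (λ s → s ⊴? t ×-dec ¬? (t ⊴? s))

    ∈-strictlyBelow⁺ : ∀ {s t} → s ⊴ t → ¬ (t ⊴ s) → s ∈ strictlyBelow t
    ∈-strictlyBelow⁺ {t = t} s⊴t t⋬s = ∈-subsetOf⁺ (λ s → s ⊴? t ×-dec ¬? (t ⊴? s)) (s⊴t , t⋬s)

    ∈-strictlyBelow⁻ : ∀ {s t} → s ∈ strictlyBelow t → s ⊴ t × ¬ (t ⊴ s)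
    ∈-strictlyBelow⁻ {t = t} = ∈-subsetOf⁻ (λ s → s ⊴? t ×-dec ¬? (t ⊴? s))

    strictlyBelow⊂ν : ∀ t → strictlyBelow t ⊂ ν t
    strictlyBelow⊂ν t = ∈-subsetOf⁺ (_⊴? t) ∘ proj₁ ∘ ∈-strictlyBelow⁻
                      , t , t∈νt t , (λ t∈ → proj₂ (∈-strictlyBelow⁻ t∈) (⊴-refl t))

    strictlyBelow-𝒱 : ∀ t → 𝒱 (strictlyBelow t)
    strictlyBelow-𝒱 t = downClosed⇒𝒱 downClosed (ν-𝒱 t) (proj₁ (strictlyBelow⊂ν t))
      where
      downClosed : DownClosed (strictlyBelow t)
      downClosed s∈ r⊴s with ∈-strictlyBelow⁻ s∈
      ... | s⊴t , t⋬s = ∈-strictlyBelow⁺ (⊴-trans r⊴s s⊴t) (λ t⊴r → t⋬s (⊴-trans t⊴r r⊴s))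

    strictlyBelow-immSucc : ∀ t → ImmSucc _⊴_ (strictlyBelow t) (ν t)
    strictlyBelow-immSucc t = strictlyBelow-𝒱 t , ν-𝒱 t , strictlyBelow⊂ν t , immediate
      where
      -- An r ⊋ strictlyBelow t contains some s with t ⊴ s, hence all of ν t.
      immediate : ∀ r → 𝒱 r → strictlyBelow t ⊂ r → ¬ (r ⊂ ν t)
      immediate r vr (_ , s , s∈r , s∉below) (r⊆νt , u , u∈νt , u∉r) with t ⊴? s
      ... | yes t⊴s = u∉r (𝒱-downClosed vr s∈r (⊴-trans (∈-subsetOf⁻ (_⊴? t) u∈νt) t⊴s))
      ... | no t⋬s  = s∉below (∈-strictlyBelow⁺ (∈-subsetOf⁻ (_⊴? t) (r⊆νt s∈r)) t⋬s)

    depth : ∀ {p} → 𝒱 p → ∃ (Depth _⊴_ p)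
    depth {p} = go (On.wellFounded ∣_∣ <-wellFounded p)
      where
      go : ∀ {p} → Acc (_<_ on ∣_∣) p → 𝒱 p → ∃ (Depth _⊴_ p)
      go _         (inj₁ refl)       = 0 , root
      go (acc rec) (inj₂ (t , p≐νt)) with isNu⇒≡ν p≐νt
      ... | refl with go (rec (p⊂q⇒∣p∣<∣q∣ (strictlyBelow⊂ν t))) (strictlyBelow-𝒱 t)
      ...   | k , d = suc k , step d (strictlyBelow-immSucc t)

    childToward-sameLevel : ∀ {m x y X Y} → 𝒱 m → ChildToward m x X → ChildToward m y Y →
                            SameLevel _⊴_ X Y
    childToward-sameLevel vm (vX , m⊂X , _ , minX) (vY , m⊂Y , _ , minY) with depth vm
    ... | k , d = suc k , step d (vm , vX , m⊂X , minX) , step d (vm , vY , m⊂Y , minY)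

    childToward-distinct⇒∩≡ : ∀ {m a b X Y} → 𝒱 a → 𝒱 b → 𝒱 m →
                              ChildToward m a X → ChildToward m b Y → X ≢ Y → a ∩ b ≡ m
    childToward-distinct⇒∩≡ {m} {a} {b} va vb vm cX@(_ , m⊂X , X⊆a , _) cY@(_ , m⊂Y , Y⊆b , _) X≢Y =
      ⊆-antisym a∩b⊆m (λ y∈m → x∈p∩q⁺ (X⊆a (p⊂q⇒p⊆q m⊂X y∈m) , Y⊆b (p⊂q⇒p⊆q m⊂Y y∈m)))
      where
      -- A point y ∈ (a ∩ b) ∖ m would put both children inside ν y.
      a∩b⊆m : a ∩ b ⊆ m
      a∩b⊆m {y} y∈a∩b with y ∈? m | x∈p∩q⁻ a b y∈a∩b
      ... | yes y∈m | _ = y∈m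
      ... | no y∉m | y∈a , y∈b =
        ⊥-elim (X≢Y (childToward-unique (ν-𝒱 y) (toward-νy va cX νy⊆a) (toward-νy vb cY νy⊆b)))
        where
        νy⊆a = ν⊆ va y∈a
        νy⊆b = ν⊆ vb y∈b
        m⊂νy : m ⊂ ν y
        m⊂νy = [ id , (λ νy⊆m → ⊥-elim (y∉m (νy⊆m (t∈νt y)))) ]′
                 (downClosed-⊆-total (𝒱-downClosed vm) (𝒱-downClosed (ν-𝒱 y)) va
                                     (⊆-trans (p⊂q⇒p⊆q m⊂X) X⊆a) νy⊆a)
             , y , t∈νt y , y∉m
        toward-νy : ∀ {c Z} → 𝒱 c → ChildToward m c Z → ν y ⊆ c → ChildToward m (ν y) Z
        toward-νy vc cZ νy⊆c = childToward-widen (childToward-least vc cZ (ν-𝒱 y) m⊂νy νy⊆c) cZ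

    module _ {_≤*_ : Rel (Subset n) 0ℓ} (LL : LevelwiseLinear _⊴_ _≤*_) where

      open LevelwiseLinear LL

      private
        _◃_ : Subset n → Subset n → Set
        _◃_ = _≺_ _⊴_ _≤*_

        _<ₗ_ : Subset n → Subset n → Set
        _<ₗ_ = _<*_ _⊴_ _≤*_

      SplitsAt : Subset n → Subset n → Subset n → Set
      SplitsAt m a b = ∃₂ λ X Y → ChildToward m a X × ChildToward m b Y × X <ₗ Y

      ◃⇒⊂⊎splits : ∀ {a b} → a ◃ b → a ⊂ b ⊎ SplitsAt (a ∩ b) a b
      ◃⇒⊂⊎splits (inj₁ a⊂b) = inj₁ a⊂b
      ◃⇒⊂⊎splits {a} {b} (inj₂ (_ , X , Y , X* , Y* , X<Y)) =
        inj₂ ( X , Y , isStar⇒childToward X*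
             , subst (λ m → ChildToward m b Y) (∩-comm b a) (isStar⇒childToward Y*) , X<Y )

      splits⇒◃ : ∀ {m a b} → a ∩ b ≡ m → SplitsAt m a b → a ◃ b
      splits⇒◃ {a = a} {b} refl (X , Y , cX , cY , X<Y) =
        inj₂ ( (childToward⇒⊈ (∩-comm b a) cX , childToward⇒⊈ refl cY)
             , X , Y , childToward⇒isStar cX
             , childToward⇒isStar (subst (λ m → ChildToward m b Y) (∩-comm a b) cY) , X<Y )

      Passed : Fin n → Subset n → Set
      Passed s q = s ∉ q × ν s ◃ q

      splits⇒passed : ∀ {s q m} → 𝒱 q → ν s ∩ q ≡ m → SplitsAt m (ν s) q → Passed s q
      splits⇒passed {s} {q} vq eq splits@(_ , _ , cX , _) =
        (λ s∈q → childToward⇒⊈ (trans (∩-comm q (ν s)) eq) cX (ν⊆ vq s∈q)) , splits⇒◃ eq splits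

      leave⇒passed : ∀ {s p q} → 𝒱 p → 𝒱 q → s ∈ p → s ∉ q → p ◃ q → Passed s q
      leave⇒passed {s} {p} {q} vp vq s∈p s∉q p◃q with ◃⇒⊂⊎splits p◃q
      ... | inj₁ p⊂q = ⊥-elim (s∉q (p⊂q⇒p⊆q p⊂q s∈p))
      ... | inj₂ (P , Q , cP , cQ , P<Q) =
        splits⇒passed vq νs∩q≡p∩q (P , Q , childToward-widen P⊆νs cP , cQ , P<Q)
        where
        p∩q⊆νs : p ∩ q ⊆ ν s
        p∩q⊆νs {y} y∈ with x∈p∩q⁻ p q y∈
        ... | y∈p , y∈q = [ ∈-subsetOf⁺ (_⊴? s) , (λ s⊴y → ⊥-elim (s∉q (𝒱-downClosed vq y∈q s⊴y))) ]′
                            (𝒱-linear vp y∈p s∈p)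
        νs∩q≡p∩q : ν s ∩ q ≡ p ∩ q
        νs∩q≡p∩q = ⊆-antisym (λ y∈ → x∈p∩q⁺ (ν⊆ vp s∈p (p∩q⊆p _ q y∈) , p∩q⊆q _ q y∈))
                             (λ y∈ → x∈p∩q⁺ (p∩q⊆νs y∈ , p∩q⊆q p q y∈))
        P⊆νs : P ⊆ ν s
        P⊆νs = childToward-least vp cP (ν-𝒱 s) (p∩q⊆νs , s , t∈νt s , λ s∈ → s∉q (p∩q⊆q p q s∈))
                                 (ν⊆ vp s∈p)

      passed-if-meet-grows : ∀ {s p q} → 𝒱 p → 𝒱 q → SplitsAt (ν s ∩ p) (ν s) p →
                             ν s ∩ p ⊂ p ∩ q → Passed s q
      passed-if-meet-grows {s} {p} {q} vp vq (X , Y , cX , cY , X<Y) m⊂p∩q@(m⊆p∩q , x , x∈p∩q , x∉m) =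
        splits⇒passed vq νs∩q≡m (X , Y , cX , childToward-widen Y⊆q cY , X<Y)
        where
        x∈p = p∩q⊆p p q x∈p∩q
        νs∩q≡m : ν s ∩ q ≡ ν s ∩ p
        νs∩q≡m = ∩-pivot vq (𝒱-downClosed (ν-𝒱 s)) (𝒱-downClosed vp) (p∩q⊆q p q x∈p∩q) x∈p
                         (λ x∈νs → x∉m (x∈p∩q⁺ (x∈νs , x∈p))) (p∩q⊆q p q ∘ m⊆p∩q)
        Y⊆q : Y ⊆ q
        Y⊆q = p∩q⊆q p q ∘ childToward-least vp cY (∩-𝒱 vp vq) m⊂p∩q (p∩q⊆p p q)

      passed-if-meet-shrinks : ∀ {s p q} → 𝒱 p → 𝒱 q → SplitsAt (p ∩ q) p q →
                               p ∩ q ⊂ ν s ∩ p → Passed s q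
      passed-if-meet-shrinks {s} {p} {q} vp vq (X , Y , cX , cY , X<Y) m⊂νs∩p@(m⊆νs∩p , x , x∈νs∩p , x∉m) =
        splits⇒passed vq νs∩q≡m (X , Y , childToward-widen X⊆νs cX , cY , X<Y)
        where
        x∈p = p∩q⊆q (ν s) p x∈νs∩p
        νs∩q≡m : ν s ∩ q ≡ p ∩ q
        νs∩q≡m = begin
          ν s ∩ q  ≡⟨ ∩-comm (ν s) q ⟩
          q ∩ ν s  ≡⟨ ∩-pivot (ν-𝒱 s) (𝒱-downClosed vq) (𝒱-downClosed vp) (p∩q⊆p (ν s) p x∈νs∩p) x∈p
                              (λ x∈q → x∉m (x∈p∩q⁺ (x∈p , x∈q)))
                              (p∩q⊆p (ν s) p ∘ m⊆νs∩p ∘ ⊆-reflexive (∩-comm q p)) ⟩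
          q ∩ p    ≡⟨ ∩-comm q p ⟩
          p ∩ q    ∎
          where open ≡-Reasoning
        X⊆νs : X ⊆ ν s
        X⊆νs = p∩q⊆p (ν s) p ∘ childToward-least vp cX (∩-𝒱 (ν-𝒱 s) vp) m⊂νs∩p (p∩q⊆q (ν s) p)

      passed-if-meets-agree : ∀ {s p q} → 𝒱 p → 𝒱 q → SplitsAt (ν s ∩ p) (ν s) p →
                              SplitsAt (ν s ∩ p) p q → Passed s q
      passed-if-meets-agree {s} {p} {q} vp vq (A , P , cA , cP , A≤P , A≢P) (P′ , Q , cP′ , cQ , P′≤Q , _) =
        splits⇒passed vq (childToward-distinct⇒∩≡ (ν-𝒱 s) vq vm cA cQ A≢Q) (A , Q , cA , cQ , A≤Q , A≢Q)
        where
        vm = ∩-𝒱 (ν-𝒱 s) vp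
        A~P = childToward-sameLevel vm cA cP
        P~Q = childToward-sameLevel vm cP cQ
        P≤Q : P ≤* Q
        P≤Q = subst (_≤* Q) (sym (childToward-unique vp cP cP′)) P′≤Q
        A≤Q : A ≤* Q
        A≤Q = ≤*-trans A~P P~Q A≤P P≤Q
        A≢Q : A ≢ Q
        A≢Q refl = A≢P (≤*-antisym A~P A≤P P≤Q)

      passed-stable : ∀ {s p q} → 𝒱 p → 𝒱 q → Passed s p → p ◃ q → Passed s q
      passed-stable {s} {p} {q} vp vq (s∉p , νs◃p) p◃q with ◃⇒⊂⊎splits νs◃p | ◃⇒⊂⊎splits p◃q
      ... | inj₁ νs⊂p | _ = ⊥-elim (s∉p (p⊂q⇒p⊆q νs⊂p (t∈νt s)))
      ... | inj₂ splits₁@(_ , _ , _ , (_ , m⊂P , P⊆p , _) , _) | inj₁ p⊂q =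
        passed-if-meet-grows vp vq splits₁
          (⊂-⊆-trans m⊂P (λ y∈P → x∈p∩q⁺ (P⊆p y∈P , p⊂q⇒p⊆q p⊂q (P⊆p y∈P))))
      ... | inj₂ splits₁ | inj₂ splits₂
        with ⊆-total⇒⊂-tri (downClosed-⊆-total (𝒱-downClosed (∩-𝒱 (ν-𝒱 s) vp)) (𝒱-downClosed (∩-𝒱 vp vq))
                                               vp (p∩q⊆q (ν s) p) (p∩q⊆p p q))
      ... | inj₁ m₁⊂m₂         = passed-if-meet-grows vp vq splits₁ m₁⊂m₂
      ... | inj₂ (inj₁ m₁≡m₂)  =
        passed-if-meets-agree vp vq splits₁ (subst (λ m → SplitsAt m p q) (sym m₁≡m₂) splits₂)
      ... | inj₂ (inj₂ m₂⊂m₁)  = passed-if-meet-shrinks vp vq splits₂ m₂⊂m₁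

      weight : ∀ {x p} → Dec (x ∈ p) → Dec (Passed x p) → ℕ
      weight (yes _) _       = 1
      weight (no _)  (yes _) = 0
      weight (no _)  (no _)  = 2

      weight≤2 : ∀ {x p} (x∈p? : Dec (x ∈ p)) (passed? : Dec (Passed x p)) → weight x∈p? passed? ≤ 2
      weight≤2 (yes _) _       = s≤s z≤n
      weight≤2 (no _)  (yes _) = z≤n
      weight≤2 (no _)  (no _)  = ≤-refl

      weight-step : ∀ {x p q} → 𝒱 p → 𝒱 q → p ◃ q →
                    (x∈p? : Dec (x ∈ p)) (passed-p? : Dec (Passed x p))
                    (x∈q? : Dec (x ∈ q)) (passed-q? : Dec (Passed x q)) →
                    weight x∈q? passed-q? ≤ weight x∈p? passed-p? ×
                    (x ∈ p △ q → weight x∈q? passed-q? < weight x∈p? passed-p?)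
      weight-step {p = p} {q} _ _ _ (yes x∈p) _ (yes x∈q) _ = ≤-refl , ⊥-elim ∘ x∈p∧x∈q⇒x∉p△q p q x∈p x∈q
      weight-step _  _  _   (yes _)   _ (no _)   (yes _)     = z≤n , λ _ → ≤-refl
      weight-step vp vq p◃q (yes x∈p) _ (no x∉q) (no ¬passed) = ⊥-elim (¬passed (leave⇒passed vp vq x∈p x∉q p◃q))
      weight-step vp vq p◃q (no _) (yes passed) (yes x∈q) _   = ⊥-elim (proj₁ (passed-stable vp vq passed p◃q) x∈q)
      weight-step _  _  _   (no _) (no _)       (yes _)   _   = s≤s z≤n , λ _ → ≤-refl
      weight-step {p = p} {q} _ _ _ (no x∉p) (yes _) (no x∉q) (yes _) = ≤-refl , ⊥-elim ∘ x∉p∧x∉q⇒x∉p△q p q x∉p x∉q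
      weight-step vp vq p◃q (no _) (yes passed) (no _) (no ¬passed) = ⊥-elim (¬passed (passed-stable vp vq passed p◃q))
      weight-step {p = p} {q} _ _ _ (no x∉p) (no _) (no x∉q) passed-q? =
        weight≤2 (no x∉q) passed-q? , ⊥-elim ∘ x∉p∧x∉q⇒x∉p△q p q x∉p x∉q

      pathLength≤2n : ∀ {m} (p : Fin (suc m) → Subset n) → (∀ i → 𝒱 (p i)) →
                      (∀ i → p (inject₁ i) ◃ p (fsuc i)) →
                      (∀ x i → Dec (Passed x (p i))) → pathLength m p ≤ 2 * n
      pathLength≤2n {m} p vp chain passed? = begin
        pathLength m p                  ≡⟨ cong sum (map-tabulate id d) ⟩
        sum (tabulate d)                ≤⟨ m≤m+n _ _ ⟩
        sum (tabulate d) + Φ (fromℕ m)  ≤⟨ sum≤telescope m Φ d descent ⟩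
        Φ fzero                         ≤⟨ sum-tabulate-≤ 2 _ (λ x → weight≤2 (x ∈? p fzero) (passed? x fzero)) ⟩
        2 * n                           ∎
        where
        open ℕ.≤-Reasoning
        Φ : Fin (suc m) → ℕ
        Φ i = sum (tabulate λ x → weight (x ∈? p i) (passed? x i))
        d : Fin m → ℕ
        d i = dist (p (inject₁ i)) (p (fsuc i))
        descent : ∀ i → d i + Φ (fsuc i) ≤ Φ (inject₁ i)
        descent i = ∣p∣+sum≤sum _ _ _ (proj₁ ∘ stepᵢ) (proj₂ ∘ stepᵢ)
          where
          stepᵢ = λ x → weight-step (vp _) (vp _) (chain i) (x ∈? p (inject₁ i)) (passed? x (inject₁ i))
                                                           (x ∈? p (fsuc i)) (passed? x (fsuc i))

lemma2p12 : (n : ℕ) (_⊴_ : Rel (Fin n) 0ℓ) → IsQuasiForest _⊴_ →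
    (_≤*_ : Rel (Subset n) 0ℓ) → LevelwiseLinear _⊴_ _≤*_ →
    (m : ℕ) (p : Fin (suc m) → Subset n) →
    (∀ i → InV _⊴_ (p i)) →
    (∀ (i : Fin m) → _≺_ _⊴_ _≤*_ (p (inject₁ i)) (p (fsuc i))) →
    pathLength m p ≤ 2 * n
lemma2p12 n _⊴_ QF _≤*_ LL m p vp chain =
  decidable-stable (pathLength m p ≤? 2 * n) λ ¬bound →
    ¬¬-∀Fin _ (λ x → ¬¬-decidable (x ⊴_)) λ _⊴?_ →
    ¬¬-∀Fin _ (λ x → ¬¬-decidable (λ i → Passed QF _⊴?_ LL x (p i))) λ passed? →
    ¬bound (pathLength≤2n QF _⊴?_ LL p vp chain passed?)
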